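{- Let $a$ be a positive integer, $A=\{a\}$, and write $a=2^kc$ with $c$ odd. Then $\mathcal P^A=\{2^{k+1}d: d \text{ a positive divisor of } c\}$.
   Context: For a finite nonempty set $A$ of positive integers let $\alpha=\max A$. For a seed $S=s_1\cdots s_\alpha\in\{0,1\}^\alpha$, define $w^{A,S}(-\alpha-1+j)=s_j$ for $j=1,\ldots,\alpha$ and $w^{A,S}(n)=1-\min\{w^{A,S}(n-x):x\in A\}$ for $n\geq0$. $\operatorname{per}(A,S)$ is the least $p\ge1$ with $w^{A,S}(n)=w^{A,S}(n+p)$ for all sufficiently large $n$, and $\mathcal P^A=\{\operatorname{per}(A,S): S\in\{0,1\}^\alpha\}$. -}

module Defs where

open import Data.Nat using (ℕ; zero; suc; _+_; _*_; _∸_; _^_; _≤_; _<_; _⊔_)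
open import Data.Bool using (Bool; true; false; not; if_then_else_)
open import Data.List using (List; []; _∷_; foldr; reverse)
open import Data.Vec using (Vec; toList)
open import Data.Product using (Σ; ∃; _×_)
open import Relation.Binary.PropositionalEquality using (_≡_)
open import Relation.Nullary using (¬_)

-- A finite nonempty set A of positive integers is represented by a list of
-- naturals (hypotheses nonempty / positive are imposed where used).
-- α = max A
maxL : List ℕ → ℕ
maxL = foldr _⊔_ 0

-- list lookup with default (default never used when 1 ≤ x ≤ α)
nth : List Bool → ℕ → Bool
nth []       _       = false
nth (b ∷ bs) zero    = b
nth (b ∷ bs) (suc i) = nth bs i

allL : {A : Set} → (A → Bool) → List A → Bool
allL f []       = true
allL f (x ∷ xs) = if f x then allL f xs else false

-- bits encode {0,1} as false = 0, true = 1.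
-- Given history L, most recent first (L at index i is w(n-1-i)),
-- the next value w(n) = 1 - min{ w(n-x) : x ∈ A }; min of bits is 1 iff all are 1.
step : List ℕ → List Bool → Bool
step A L = not (allL (λ x → nth L (x ∸ 1)) A)

-- hist A S n = [w(n-1), w(n-2), ..., w(-α)]   (S = s_1 ... s_α, w(-α-1+j) = s_j)
hist : (A : List ℕ) → Vec Bool (maxL A) → ℕ → List Bool
hist A S zero    = reverse (toList S)
hist A S (suc n) = step A (hist A S n) ∷ hist A S n

w : (A : List ℕ) → Vec Bool (maxL A) → ℕ → Bool
w A S n = step A (hist A S n)

EventualPeriod : (ℕ → Bool) → ℕ → Set
EventualPeriod f p = ∃ λ N → ∀ n → N ≤ n → f n ≡ f (n + p)

IsPer : (A : List ℕ) → Vec Bool (maxL A) → ℕ → Set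
IsPer A S p = (1 ≤ p) × EventualPeriod (w A S) p
            × (∀ q → 1 ≤ q → q < p → ¬ EventualPeriod (w A S) q)

InPeriodSet : List ℕ → ℕ → Set
InPeriodSet A p = ∃ λ (S : Vec Bool (maxL A)) → IsPer A S p

Odd : ℕ → Set
Odd c = ∃ λ m → c ≡ suc (2 * m)

module Submission where

-- For A = {a} the recurrence reads w(n) = 1 - w(n - a), and since the seed is arbitrary the
-- sequences w^{A,S} are exactly the a-antiperiodic ones.  Such a sequence has period 2a but not
-- period a, so its minimal period divides 2a but not a = 2^k c, which forces it to be 2^{k+1} d
-- with d | c.  Conversely, if d | c then c/d is odd, so the square wave of half-period 2^k d is
-- a-antiperiodic, and its minimal period is 2^{k+1} d.

open import Defs
open import Data.Bool using (Bool; true; false; not)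
open import Data.Bool.Properties using (not-involutive; not-¬)
open import Data.Empty using (⊥-elim)
open import Data.List using ([]; _∷_; reverse)
open import Data.List.Properties using (reverse-involutive)
open import Data.Nat using (ℕ; zero; suc; _+_; _*_; _^_; _∸_; _≤_; _<_; z≤n; s≤s; NonZero; >-nonZero; >-nonZero⁻¹; _≟_)
open import Data.Nat.Properties
open import Data.Nat.DivMod using (_/_; _%_; m≡m%n+[m/n]*n; m%n<n; +-distrib-/-∣ʳ; n/n≡1; m*n/n≡m; m<n⇒m/n≡0)
open import Data.Nat.Divisibility using (_∣_; divides; divides-refl; ∣-refl; m%n≡0⇒n∣m; *-cancelˡ-∣; *-monoʳ-∣; 0∣⇒≡0)
open import Data.Nat.Tactic.RingSolver using (solve-∀)
open import Data.Product using (∃; _×_; _,_)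
open import Data.Sum using (_⊎_; inj₁; inj₂)
open import Data.Vec using (Vec; toList)
import Data.Vec as Vec
open import Data.Vec.Properties using (toList-reverse)
open import Function using (_∘_)
open import Function.Bundles using (_⇔_; mk⇔; Equivalence)
open import Relation.Nullary using (¬_; yes; no)
open import Relation.Binary.PropositionalEquality

PeriodFrom : (ℕ → Bool) → ℕ → ℕ → Set
PeriodFrom f N p = ∀ n → N ≤ n → f n ≡ f (n + p)

-- IsPer A S p unfolds to MinimalPeriod (w A S) p.
MinimalPeriod : (ℕ → Bool) → ℕ → Set
MinimalPeriod f p = (1 ≤ p) × EventualPeriod f p × (∀ q → 1 ≤ q → q < p → ¬ EventualPeriod f q)

Antiperiodic : (ℕ → Bool) → ℕ → Set
Antiperiodic f a = ∀ n → f (n + a) ≡ not (f n)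

module _ {f : ℕ → Bool} where

  periodFrom-* : ∀ {N p} → PeriodFrom f N p → ∀ m → PeriodFrom f N (m * p)
  periodFrom-* hp zero n _ = cong f (sym (+-identityʳ n))
  periodFrom-* {p = p} hp (suc m) n N≤n = begin
    f n               ≡⟨ periodFrom-* hp m n N≤n ⟩
    f (n + m * p)     ≡⟨ hp (n + m * p) (≤-trans N≤n (m≤m+n n _)) ⟩
    f (n + m * p + p) ≡⟨ cong f (trans (+-assoc n (m * p) p) (cong (n +_) (+-comm (m * p) p))) ⟩
    f (n + (p + m * p)) ∎
    where open ≡-Reasoning

  -- The remainder of P modulo p would be a smaller eventual period.
  minimalPeriod-∣ : ∀ {p P} → MinimalPeriod f p → EventualPeriod f P → p ∣ P
  minimalPeriod-∣ {zero} (() , _)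
  minimalPeriod-∣ {p@(suc _)} {P} (_ , (N , hp) , minimal) (M , hP) with P % p ≟ 0
  ... | yes r≡0 = m%n≡0⇒n∣m P p r≡0
  ... | no r≢0 = ⊥-elim (minimal r (n≢0⇒n>0 r≢0) (m%n<n P p) (N + M , remainder-period))
    where
    r = P % p
    remainder-period : PeriodFrom f (N + M) r
    remainder-period n N+M≤n = begin
      f n                       ≡⟨ hP n (≤-trans (m≤n+m M N) N+M≤n) ⟩
      f (n + P)                 ≡⟨ cong f (trans (cong (n +_) (m≡m%n+[m/n]*n P p)) (sym (+-assoc n r _))) ⟩
      f (n + r + (P / p) * p)   ≡⟨ periodFrom-* hp (P / p) (n + r) (≤-trans (m≤m+n N M) (≤-trans N+M≤n (m≤m+n n r))) ⟨
      f (n + r)                 ∎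
      where open ≡-Reasoning

  antiperiodic⇒periodic : ∀ {a} → Antiperiodic f a → PeriodFrom f 0 (2 * a)
  antiperiodic⇒periodic {a} anti n _ = sym (begin
    f (n + 2 * a)   ≡⟨ cong f (n+2a≡n+a+a n a) ⟩
    f (n + a + a)   ≡⟨ anti (n + a) ⟩
    not (f (n + a)) ≡⟨ cong not (anti n) ⟩
    not (not (f n)) ≡⟨ not-involutive (f n) ⟩
    f n             ∎)
    where
    open ≡-Reasoning
    n+2a≡n+a+a : ∀ n a → n + 2 * a ≡ n + a + a
    n+2a≡n+a+a = solve-∀

  antiperiodic⇒¬eventualPeriod : ∀ {a} → Antiperiodic f a → ¬ EventualPeriod f a
  antiperiodic⇒¬eventualPeriod anti (N , hp) = not-¬ refl (trans (hp N ≤-refl) (anti N))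

  antiperiodic-*odd : ∀ {q} → Antiperiodic f q → ∀ t → Antiperiodic f (suc (2 * t) * q)
  antiperiodic-*odd {q} anti t n = begin
    f (n + suc (2 * t) * q)   ≡⟨ cong f (regroup n q t) ⟩
    f (n + q + t * (2 * q))   ≡⟨ periodFrom-* (antiperiodic⇒periodic anti) t (n + q) z≤n ⟨
    f (n + q)                 ≡⟨ anti n ⟩
    not (f n)                 ∎
    where
    open ≡-Reasoning
    regroup : ∀ n q t → n + suc (2 * t) * q ≡ n + q + t * (2 * q)
    regroup = solve-∀

  minimalPeriod-antiperiodic : ∀ {p a} → MinimalPeriod f p → Antiperiodic f a → p ∣ 2 * a × ¬ p ∣ a
  minimalPeriod-antiperiodic mp@(_ , (N , hp) , _) anti =
      minimalPeriod-∣ mp (0 , antiperiodic⇒periodic anti)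
    , λ { (divides t a≡t*p) → antiperiodic⇒¬eventualPeriod anti
            (N , subst (PeriodFrom f N) (sym a≡t*p) (periodFrom-* hp t)) }

eventualPeriod-cong : ∀ {f g p} → (∀ n → f n ≡ g n) → EventualPeriod f p → EventualPeriod g p
eventualPeriod-cong f≗g (N , hp) = N , λ n N≤n → trans (sym (f≗g n)) (trans (hp n N≤n) (f≗g _))

minimalPeriod-cong : ∀ {f g p} → (∀ n → f n ≡ g n) → MinimalPeriod f p → MinimalPeriod g p
minimalPeriod-cong f≗g (p≥1 , ep , minimal) =
  p≥1 , eventualPeriod-cong f≗g ep , λ q q≥1 q<p → minimal q q≥1 q<p ∘ eventualPeriod-cong (sym ∘ f≗g)

antiperiodic-unique : ∀ {f g a} .{{_ : NonZero a}} → Antiperiodic f a → Antiperiodic g a →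
                      (∀ n → n < a → f n ≡ g n) → ∀ n → f n ≡ g n
antiperiodic-unique {f} {g} {a} antif antig agree n = begin
  f n                    ≡⟨ cong f (m≡m%n+[m/n]*n n a) ⟩
  f (n % a + n / a * a)  ≡⟨ agree-shifted (n / a) ⟩
  g (n % a + n / a * a)  ≡⟨ cong g (m≡m%n+[m/n]*n n a) ⟨
  g n                    ∎
  where
  open ≡-Reasoning
  s = n % a
  agree-shifted : ∀ k → f (s + k * a) ≡ g (s + k * a)
  agree-shifted zero = subst (λ m → f m ≡ g m) (sym (+-identityʳ s)) (agree s (m%n<n n a))
  agree-shifted (suc k) = begin
    f (s + (a + k * a))    ≡⟨ cong f shift ⟩
    f (s + k * a + a)      ≡⟨ antif (s + k * a) ⟩
    not (f (s + k * a))    ≡⟨ cong not (agree-shifted k) ⟩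
    not (g (s + k * a))    ≡⟨ antig (s + k * a) ⟨
    g (s + k * a + a)      ≡⟨ cong g shift ⟨
    g (s + (a + k * a))    ∎
    where
    shift : s + (a + k * a) ≡ s + k * a + a
    shift = trans (cong (s +_) (+-comm a (k * a))) (sym (+-assoc s (k * a) a))

even-or-odd : ∀ n → ∃ λ u → n ≡ 2 * u ⊎ n ≡ suc (2 * u)
even-or-odd zero = 0 , inj₁ refl
even-or-odd (suc n) with even-or-odd n
... | u , inj₁ refl = u , inj₂ refl
... | u , inj₂ refl = suc u , inj₁ (sym (*-suc 2 u))

odd∣2*⇒∣ : ∀ u x → suc (2 * u) ∣ 2 * x → suc (2 * u) ∣ x
odd∣2*⇒∣ u x (divides t 2x≡t*o) with even-or-odd t
... | v , inj₁ refl = divides v (*-cancelˡ-≡ x (v * suc (2 * u)) 2 (trans 2x≡t*o (*-assoc 2 v _)))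
... | v , inj₂ refl = ⊥-elim (even≢odd x (u + v * suc (2 * u)) (trans 2x≡t*o (odd*odd u v)))
  where
  odd*odd : ∀ u v → suc (2 * v) * suc (2 * u) ≡ suc (2 * (u + v * suc (2 * u)))
  odd*odd = solve-∀

∣2*∧∤⇒≡2^[1+k]* : ∀ k {c p} → p ∣ 2 * (2 ^ k * c) → ¬ p ∣ 2 ^ k * c → ∃ λ d → d ∣ c × p ≡ 2 ^ suc k * d
∣2*∧∤⇒≡2^[1+k]* k {c} {p} p∣2x p∤x with even-or-odd p
∣2*∧∤⇒≡2^[1+k]* k {c} p∣2x p∤x | u , inj₂ refl = ⊥-elim (p∤x (odd∣2*⇒∣ u _ p∣2x))
∣2*∧∤⇒≡2^[1+k]* zero {c} p∣2x p∤x | u , inj₁ refl =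
  u , *-cancelˡ-∣ 2 (subst (2 * u ∣_) (cong (2 *_) (*-identityˡ c)) p∣2x) , refl
∣2*∧∤⇒≡2^[1+k]* (suc k) {c} p∣2x p∤x | u , inj₁ refl
  with ∣2*∧∤⇒≡2^[1+k]* k {c} {u} (*-cancelˡ-∣ 2 (subst (2 * u ∣_) (cong (2 *_) (*-assoc 2 (2 ^ k) c)) p∣2x))
         (λ u∣x → p∤x (subst (2 * u ∣_) (sym (*-assoc 2 (2 ^ k) c)) (*-monoʳ-∣ 2 u∣x)))
... | d , d∣c , refl = d , d∣c , sym (*-assoc 2 (2 * 2 ^ k) d)

odd-∣⇒odd-cofactor : ∀ {c d} → Odd c → d ∣ c → ∃ λ t → c ≡ suc (2 * t) * d
odd-∣⇒odd-cofactor {c} {d} (m , c≡) (divides t c≡t*d) with even-or-odd t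
... | u , inj₁ refl = ⊥-elim (even≢odd (u * d) m (trans (sym (*-assoc 2 u d)) (trans (sym c≡t*d) c≡)))
... | u , inj₂ refl = u , c≡t*d

odd-∣⇒positive : ∀ {c d} → Odd c → d ∣ c → 1 ≤ d
odd-∣⇒positive {d = zero} (m , c≡) 0∣c with trans (sym (0∣⇒≡0 0∣c)) c≡
... | ()
odd-∣⇒positive {d = suc d} _ _ = s≤s z≤n

isEven : ℕ → Bool
isEven zero = true
isEven (suc n) = not (isEven n)

isEven-2* : ∀ n → isEven (2 * n) ≡ true
isEven-2* zero = refl
isEven-2* (suc n) rewrite +-suc n (n + 0) = trans (not-involutive (isEven (2 * n))) (isEven-2* n)

isEven-1+2* : ∀ n → isEven (suc (2 * n)) ≡ false
isEven-1+2* n = cong not (isEven-2* n)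

squareWave : (q : ℕ) .{{_ : NonZero q}} → ℕ → Bool
squareWave q n = isEven (n / q)

crossing-step : ∀ {q r} .{{_ : NonZero q}} → 1 ≤ r → r < 2 * q →
                ∃ λ s → ∃ λ s′ → s < q × s′ < q × s + r ≡ q + s′
crossing-step {q} {r} r≥1 r<2q with ≤-total r q
... | inj₁ r≤q = q ∸ r , 0 , ∸-monoʳ-< r≥1 r≤q , >-nonZero⁻¹ q , trans (m∸n+n≡m r≤q) (sym (+-identityʳ q))
... | inj₂ q≤r = 0 , r ∸ q , >-nonZero⁻¹ q
                , m<n+o⇒m∸n<o r q (subst (r <_) (cong (q +_) (+-identityʳ q)) r<2q) , sym (m+[n∸m]≡n q≤r)

module _ (q : ℕ) .{{_ : NonZero q}} where

  squareWave-block : ∀ k s → s < q → squareWave q (k * q + s) ≡ isEven k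
  squareWave-block k s s<q = cong isEven (begin
    (k * q + s) / q      ≡⟨ cong (_/ q) (+-comm (k * q) s) ⟩
    (s + k * q) / q      ≡⟨ +-distrib-/-∣ʳ s (divides-refl k) ⟩
    s / q + k * q / q    ≡⟨ cong₂ _+_ (m<n⇒m/n≡0 s<q) (m*n/n≡m k q) ⟩
    k                    ∎)
    where open ≡-Reasoning

  squareWave-antiperiodic : Antiperiodic (squareWave q) q
  squareWave-antiperiodic n = begin
    isEven ((n + q) / q)     ≡⟨ cong isEven (+-distrib-/-∣ʳ n ∣-refl) ⟩
    isEven (n / q + q / q)   ≡⟨ cong (λ m → isEven (n / q + m)) (n/n≡1 q) ⟩
    isEven (n / q + 1)       ≡⟨ cong isEven (+-comm (n / q) 1) ⟩
    not (isEven (n / q))     ∎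
    where open ≡-Reasoning

  squareWave-minimalPeriod : MinimalPeriod (squareWave q) (2 * q)
  squareWave-minimalPeriod =
    *-mono-≤ (s≤s (z≤n {1})) (>-nonZero⁻¹ q) , (0 , antiperiodic⇒periodic squareWave-antiperiodic) , not-period
    where
    not-period : ∀ r → 1 ≤ r → r < 2 * q → ¬ EventualPeriod (squareWave q) r
    not-period r r≥1 r<2q (N , hp) with crossing-step r≥1 r<2q
    ... | s , s′ , s<q , s′<q , s+r≡q+s′ = not-¬ refl (begin
      true                                     ≡⟨ isEven-2* N ⟨
      isEven (2 * N)                           ≡⟨ squareWave-block (2 * N) s s<q ⟨
      squareWave q (2 * N * q + s)             ≡⟨ hp _ (≤-trans (m≤m+n N (N + 0)) (≤-trans (m≤m*n (2 * N) q) (m≤m+n _ s))) ⟩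
      squareWave q (2 * N * q + s + r)         ≡⟨ cong (squareWave q) (next-half-window (2 * N) s r s′ s+r≡q+s′) ⟩
      squareWave q (suc (2 * N) * q + s′)      ≡⟨ squareWave-block (suc (2 * N)) s′ s′<q ⟩
      isEven (suc (2 * N))                     ≡⟨ isEven-1+2* N ⟩
      false                                    ∎)
      where
      open ≡-Reasoning
      next-half-window : ∀ m s r s′ → s + r ≡ q + s′ → m * q + s + r ≡ suc m * q + s′
      next-half-window m s r s′ e = begin
        m * q + s + r      ≡⟨ +-assoc (m * q) s r ⟩
        m * q + (s + r)    ≡⟨ cong (m * q +_) e ⟩
        m * q + (q + s′)   ≡⟨ +-assoc (m * q) q s′ ⟨
        m * q + q + s′     ≡⟨ cong (_+ s′) (+-comm (m * q) q) ⟩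
        suc m * q + s′     ∎

nth-hist-w : ∀ A S j n → nth (hist A S (suc j + n)) j ≡ w A S n
nth-hist-w A S zero n = refl
nth-hist-w A S (suc j) n = nth-hist-w A S j n

nth-hist-initial : ∀ A S n i → nth (hist A S n) (n + i) ≡ nth (hist A S 0) i
nth-hist-initial A S zero i = refl
nth-hist-initial A S (suc n) i = nth-hist-initial A S n i

initialSegment : (ℕ → Bool) → (m : ℕ) → Vec Bool m
initialSegment h zero = Vec.[]
initialSegment h (suc m) = h 0 Vec.∷ initialSegment (h ∘ suc) m

nth-initialSegment : ∀ h {m i} → i < m → nth (toList (initialSegment h m)) i ≡ h i
nth-initialSegment h {i = zero} (s≤s _) = refl
nth-initialSegment h {i = suc i} (s≤s i<m) = nth-initialSegment (h ∘ suc) i<m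

-- Seeds are stored oldest first, so the most recent value w(-1) is the last entry of S.
module _ (a′ : ℕ) where

  w-singleton : ∀ S n → w (suc a′ ∷ []) S n ≡ not (nth (hist (suc a′ ∷ []) S n) a′)
  w-singleton S n with nth (hist (suc a′ ∷ []) S n) a′
  ... | true = refl
  ... | false = refl

  w-antiperiodic : ∀ S → Antiperiodic (w (suc a′ ∷ []) S) (suc a′)
  w-antiperiodic S n = begin
    w A S (n + suc a′)                     ≡⟨ cong (w A S) (+-comm n (suc a′)) ⟩
    w A S (suc a′ + n)                     ≡⟨ w-singleton S (suc a′ + n) ⟩
    not (nth (hist A S (suc a′ + n)) a′)   ≡⟨ cong not (nth-hist-w A S a′ n) ⟩
    not (w A S n)                          ∎
    where
    open ≡-Reasoning
    A = suc a′ ∷ []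

  w-initial : ∀ S n → n ≤ a′ → w (suc a′ ∷ []) S n ≡ not (nth (reverse (toList S)) (a′ ∸ n))
  w-initial S n n≤a′ = trans (w-singleton S n) (cong not (begin
    nth (hist A S n) a′              ≡⟨ cong (nth (hist A S n)) (m+[n∸m]≡n n≤a′) ⟨
    nth (hist A S n) (n + (a′ ∸ n))  ≡⟨ nth-hist-initial A S n (a′ ∸ n) ⟩
    nth (hist A S 0) (a′ ∸ n)        ∎))
    where
    open ≡-Reasoning
    A = suc a′ ∷ []

  w-realizes : ∀ F → Antiperiodic F (suc a′) → ∃ λ S → ∀ n → w (suc a′ ∷ []) S n ≡ F n
  w-realizes F anti = S , antiperiodic-unique (w-antiperiodic S) anti agree
    where
    h : ℕ → Bool
    h i = not (F (a′ ∸ i))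
    S : Vec Bool (suc a′)
    S = Vec.reverse (initialSegment h (suc a′))
    reverse-seed : reverse (toList S) ≡ toList (initialSegment h (suc a′))
    reverse-seed = trans (cong reverse (toList-reverse (initialSegment h (suc a′)))) (reverse-involutive _)
    agree : ∀ n → n < suc a′ → w (suc a′ ∷ []) S n ≡ F n
    agree n (s≤s n≤a′) = begin
      w (suc a′ ∷ []) S n                          ≡⟨ w-initial S n n≤a′ ⟩
      not (nth (reverse (toList S)) (a′ ∸ n))      ≡⟨ cong (λ xs → not (nth xs (a′ ∸ n))) reverse-seed ⟩
      not (nth (toList (initialSegment h (suc a′))) (a′ ∸ n))
                                                   ≡⟨ cong not (nth-initialSegment h (s≤s (m∸n≤m a′ n))) ⟩
      not (not (F (a′ ∸ (a′ ∸ n))))                ≡⟨ not-involutive _ ⟩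
      F (a′ ∸ (a′ ∸ n))                            ≡⟨ cong F (m∸[m∸n]≡n n≤a′) ⟩
      F n                                          ∎
      where open ≡-Reasoning

  inPeriodSet⇔minimalPeriod-of-antiperiodic : ∀ p →
    InPeriodSet (suc a′ ∷ []) p ⇔ (∃ λ F → Antiperiodic F (suc a′) × MinimalPeriod F p)
  inPeriodSet⇔minimalPeriod-of-antiperiodic p = mk⇔
    (λ { (S , per) → w (suc a′ ∷ []) S , w-antiperiodic S , per })
    (λ { (F , anti , mp) → let S , w≗F = w-realizes F anti in S , minimalPeriod-cong (sym ∘ w≗F) mp })

squareWave-realizes : ∀ k {c d} → Odd c → d ∣ c →
                      ∃ λ F → Antiperiodic F (2 ^ k * c) × MinimalPeriod F (2 ^ suc k * d)
squareWave-realizes k {c} {d} odd-c d∣c with odd-∣⇒odd-cofactor odd-c d∣c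
... | t , c≡[1+2t]d = squareWave q , antiperiodic , minimal
  where
  instance q≢0 : NonZero (2 ^ k * d)
           q≢0 = >-nonZero (*-mono-≤ (m^n>0 2 k) (odd-∣⇒positive odd-c d∣c))
  q = 2 ^ k * d
  a≡[1+2t]q : 2 ^ k * c ≡ suc (2 * t) * q
  a≡[1+2t]q = trans (cong (2 ^ k *_) c≡[1+2t]d) (regroup (2 ^ k) t d)
    where
    regroup : ∀ x t d → x * (suc (2 * t) * d) ≡ suc (2 * t) * (x * d)
    regroup = solve-∀
  antiperiodic : Antiperiodic (squareWave q) (2 ^ k * c)
  antiperiodic = subst (Antiperiodic (squareWave q)) (sym a≡[1+2t]q)
                   (antiperiodic-*odd (squareWave-antiperiodic q) t)
  minimal : MinimalPeriod (squareWave q) (2 ^ suc k * d)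
  minimal = subst (MinimalPeriod (squareWave q)) (sym (*-assoc 2 (2 ^ k) d)) (squareWave-minimalPeriod q)

proposition3p2 : (a k c : ℕ) → 1 ≤ a → Odd c → a ≡ 2 ^ k * c →
    (p : ℕ) → InPeriodSet (a ∷ []) p ⇔ (∃ λ d → (1 ≤ d) × (d ∣ c) × (p ≡ 2 ^ (k + 1) * d))
proposition3p2 (suc a′) k c _ odd-c a≡2^k*c p = mk⇔ periods⇒form form⇒periods
  where
  open Equivalence (inPeriodSet⇔minimalPeriod-of-antiperiodic a′ p) using (to; from)
  2^[1+k]≡2^[k+1] : 2 ^ suc k ≡ 2 ^ (k + 1)
  2^[1+k]≡2^[k+1] = cong (2 ^_) (+-comm 1 k)
  periods⇒form : InPeriodSet (suc a′ ∷ []) p → ∃ λ d → (1 ≤ d) × (d ∣ c) × (p ≡ 2 ^ (k + 1) * d)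
  periods⇒form p∈ with to p∈
  ... | F , anti , mp with minimalPeriod-antiperiodic mp (subst (Antiperiodic F) a≡2^k*c anti)
  ... | p∣2a , p∤a with ∣2*∧∤⇒≡2^[1+k]* k p∣2a p∤a
  ... | d , d∣c , p≡ = d , odd-∣⇒positive odd-c d∣c , d∣c , trans p≡ (cong (_* d) 2^[1+k]≡2^[k+1])
  form⇒periods : (∃ λ d → (1 ≤ d) × (d ∣ c) × (p ≡ 2 ^ (k + 1) * d)) → InPeriodSet (suc a′ ∷ []) p
  form⇒periods (d , _ , d∣c , p≡) with squareWave-realizes k odd-c d∣c
  ... | F , anti , mp = from (F , subst (Antiperiodic F) (sym a≡2^k*c) anti
                                , subst (MinimalPeriod F) (trans (cong (_* d) 2^[1+k]≡2^[k+1]) (sym p≡)) mp)
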